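{- Let $G$ be a connected cubic finite simple graph with vertex set $V(G)=\{v_1,\ldots,v_n\}$. Let $G_L$ be the graph with vertex set $V(G)\cup\{x_1,\dots,x_n\}\cup\{y_1,\dots,y_n\}$ (the $x_i,y_i$ being $2n$ new distinct vertices) and edge set $E(G)\cup\{x_iy_i,\,y_iv_i,\,v_ix_i : i\in\{1,\dots,n\}\}$. Let $g\equiv 1$ on $V(G_L)$ and let $f:V(G_L)\rightarrow\mathbb{Z}_{\ge 0}$ be given by $f(u)=2$ if $u\in V(G)$ and $f(u)=1$ if $u\in V(G_L)\setminus V(G)$. Then $G$ contains an $H$-factor for every $H:V(G)\rightarrow\{\{1\},\{0,2\}\}$ with $|H^{ -1}(1)|$ even if and only if $G_L$ has all $(g,f)$-factors.
   Context: For a set function $H$ assigning to each vertex $v$ of $G$ a set $H(v)$ of nonnegative integers, an $H$-factor of $G$ is a spanning subgraph $F$ with $d_F(v)\in H(v)$ for every $v\in V(G)$, and $H^{ -1}(1):=\{v\in V(G): H(v)=\{1\}\}$. For $h:V\rightarrow\mathbb{Z}_{\ge 0}$, an $h$-factor is a spanning subgraph $F$ with $d_F(v)=h(v)$ for every $v$. Given $g\le f$, a graph has all $(g,f)$-factors if it has an $h$-factor for every $h:V\rightarrow\mathbb{Z}_{\ge0}$ with $g(v)\le h(v)\le f(v)$ for all $v$ and $\sum_{v}h(v)\equiv 0\pmod 2$. -}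

module Defs where

open import Data.Nat using (ℕ; zero; suc; _+_; _≤_)
open import Data.Nat.Divisibility using (_∣_)
open import Data.Bool using (Bool; true; false; if_then_else_)
open import Data.Fin using (Fin; zero; suc; splitAt; _≟_)
open import Data.Sum using (_⊎_; inj₁; inj₂)
open import Data.Product using (Σ; _×_; _,_)
open import Relation.Nullary.Decidable using (⌊_⌋)
open import Relation.Binary.PropositionalEquality using (_≡_)

Graph : ℕ → Set
Graph m = Fin m → Fin m → Bool

Simple : ∀ {m} → Graph m → Set
Simple {m} G = (∀ u v → G u v ≡ G v u) × (∀ v → G v v ≡ false)

Σ[_] : ∀ m → (Fin m → ℕ) → ℕ
Σ[ zero ] h = 0
Σ[ suc m ] h = h zero + Σ[ m ] (λ i → h (suc i))

deg : ∀ {m} → Graph m → Fin m → ℕ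
deg {m} G v = Σ[ m ] (λ w → if G v w then 1 else 0)

data Walk {m} (G : Graph m) : Fin m → Fin m → Set where
  here : ∀ {u} → Walk G u u
  step : ∀ {u v w} → G u v ≡ true → Walk G v w → Walk G u w

Connected : ∀ {m} → Graph m → Set
Connected {m} G = ∀ (u v : Fin m) → Walk G u v

Cubic : ∀ {m} → Graph m → Set
Cubic {m} G = ∀ (v : Fin m) → deg G v ≡ 3

SpanningSubgraph : ∀ {m} → Graph m → Graph m → Set
SpanningSubgraph {m} G F =
  (∀ u v → F u v ≡ F v u) × (∀ u v → F u v ≡ true → G u v ≡ true)

SetFunction : ℕ → Set₁
SetFunction m = Fin m → ℕ → Set

HFactor : ∀ {m} → Graph m → SetFunction m → Set
HFactor {m} G H = Σ (Graph m) λ F → SpanningSubgraph G F × (∀ v → H v (deg F v))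

hFactor : ∀ {m} → Graph m → (Fin m → ℕ) → Set
hFactor {m} G h = Σ (Graph m) λ F → SpanningSubgraph G F × (∀ v → deg F v ≡ h v)

AllFactors : ∀ {m} → Graph m → (g f : Fin m → ℕ) → Set
AllFactors {m} G g f =
  ∀ (h : Fin m → ℕ) → (∀ v → g v ≤ h v × h v ≤ f v) → 2 ∣ Σ[ m ] h → hFactor G h

data OneOrZeroTwo : Set where
  one zeroTwo : OneOrZeroTwo

⟦_⟧ : OneOrZeroTwo → ℕ → Set
⟦ one ⟧ d = d ≡ 1
⟦ zeroTwo ⟧ d = (d ≡ 0) ⊎ (d ≡ 2)

isOne : OneOrZeroTwo → ℕ
isOne one = 1
isOne zeroTwo = 0

countOnes : ∀ {m} → (Fin m → OneOrZeroTwo) → ℕ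
countOnes {m} H = Σ[ m ] (λ v → isOne (H v))

-- vertices of G_L : Fin (n + (n + n)); the first block is V(G) (v_i),
-- the second block the x_i, the third the y_i.
data Kind (n : ℕ) : Set where
  vK xK yK : Fin n → Kind n

kind : ∀ {n} → Fin (n + (n + n)) → Kind n
kind {n} u with splitAt n u
... | inj₁ i = vK i
... | inj₂ j with splitAt n j
...   | inj₁ i = xK i
...   | inj₂ i = yK i

eqB : ∀ {n} → Fin n → Fin n → Bool
eqB i j = ⌊ i ≟ j ⌋

LAdjK : ∀ {n} → Graph n → Kind n → Kind n → Bool
LAdjK G (vK i) (vK j) = G i j
LAdjK G (vK i) (xK j) = eqB i j
LAdjK G (vK i) (yK j) = eqB i j
LAdjK G (xK i) (vK j) = eqB i j
LAdjK G (xK i) (xK j) = false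
LAdjK G (xK i) (yK j) = eqB i j
LAdjK G (yK i) (vK j) = eqB i j
LAdjK G (yK i) (xK j) = eqB i j
LAdjK G (yK i) (yK j) = false

GL : ∀ {n} → Graph n → Graph (n + (n + n))
GL {n} G u w = LAdjK G (kind {n} u) (kind {n} w)

gL : ∀ n → Fin (n + (n + n)) → ℕ
gL n _ = 1

fK : ∀ {n} → Kind n → ℕ
fK (vK _) = 2
fK (xK _) = 1
fK (yK _) = 1

fL : ∀ n → Fin (n + (n + n)) → ℕ
fL n u = fK (kind {n} u)

-- In a factor of G_L in which x_i and y_i have degree 1, the triangle
-- v_i x_i y_i contributes either the single edge x_i y_i or the two
-- edges v_i x_i, v_i y_i; so it adds 0 or 2 to the degree of v_i.  Hence
-- the factors of G_L with h(v_i) ∈ {1,2} and h(x_i) = h(y_i) = 1 are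
-- exactly the H-factors of G with H(v_i) = {1} iff h(v_i) = 1, completed
-- by the triangles.  Since Σ h = Σ_i h(v_i) + 2n and h(v_i) + [H(v_i) = {1}]
-- = 2, the parity conditions on both sides agree.
module Submission where

open import Defs
open import Data.Nat using (ℕ; zero; suc; _+_; _*_; _≤_; _≡ᵇ_; z≤n; s≤s)
open import Data.Nat.Properties
  using ( +-assoc; +-comm; +-identityʳ; +-cancelˡ-≡; +-cancelʳ-≡; *-zeroʳ; *-suc
        ; ≤-antisym; ≤-refl; +-commutativeSemigroup)
open import Data.Nat.Divisibility using (_∣_; ∣m∣n⇒∣m+n; ∣m+n∣m⇒∣n; m∣m*n)
open import Algebra.Properties.CommutativeSemigroup +-commutativeSemigroup using (interchange)
open import Data.Bool using (Bool; true; false; if_then_else_; _∧_; not)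
open import Data.Bool.Properties using (∧-conicalˡ; ¬-not)
open import Data.Fin using (Fin; zero; suc; splitAt; _≟_; _↑ˡ_; _↑ʳ_)
open import Data.Fin.Properties using (splitAt-↑ˡ; splitAt-↑ʳ; splitAt⁻¹-↑ˡ; splitAt⁻¹-↑ʳ)
open import Data.Sum using (inj₁; inj₂)
open import Data.Product using (_×_; _,_; proj₁; proj₂)
open import Data.Empty using (⊥; ⊥-elim)
open import Function using (_∘_; _⇔_; mk⇔; Equivalence)
open import Function.Construct.Composition using (_⇔-∘_)
open import Relation.Binary.PropositionalEquality
open import Relation.Nullary using (yes; no)

ind : Bool → ℕ
ind b = if b then 1 else 0

Σ-cong : ∀ m {h h′ : Fin m → ℕ} → (∀ i → h i ≡ h′ i) → Σ[ m ] h ≡ Σ[ m ] h′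
Σ-cong zero    e = refl
Σ-cong (suc m) e = cong₂ _+_ (e zero) (Σ-cong m (e ∘ suc))

Σ-++ : ∀ m k (h : Fin (m + k) → ℕ) →
  Σ[ m + k ] h ≡ Σ[ m ] (h ∘ (_↑ˡ k)) + Σ[ k ] (h ∘ (m ↑ʳ_))
Σ-++ zero    k h = refl
Σ-++ (suc m) k h = trans (cong (h zero +_) (Σ-++ m k (h ∘ suc))) (sym (+-assoc (h zero) _ _))

Σ-+ : ∀ m (h h′ : Fin m → ℕ) → Σ[ m ] (λ i → h i + h′ i) ≡ Σ[ m ] h + Σ[ m ] h′
Σ-+ zero    h h′ = refl
Σ-+ (suc m) h h′ =
  trans (cong (h zero + h′ zero +_) (Σ-+ m (h ∘ suc) (h′ ∘ suc)))
        (interchange (h zero) (h′ zero) _ _)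

Σ-const : ∀ m c → Σ[ m ] (λ _ → c) ≡ c * m
Σ-const zero    c = sym (*-zeroʳ c)
Σ-const (suc m) c = trans (cong (c +_) (Σ-const m c)) (sym (*-suc c m))

eqB-∧-sym : ∀ {n} (i j : Fin n) (b : Fin n → Bool) → eqB i j ∧ b i ≡ eqB j i ∧ b j
eqB-∧-sym i j b with i ≟ j | j ≟ i
... | yes refl | yes _   = refl
... | yes refl | no j≢i  = ⊥-elim (j≢i refl)
... | no i≢j   | yes refl = ⊥-elim (i≢j refl)
... | no _     | no _    = refl

eqB-suc : ∀ {n} (i j : Fin n) → eqB (suc i) (suc j) ≡ eqB i j
eqB-suc i j with i ≟ j
... | yes _ = refl
... | no _  = refl

Σ-ind-eqB : ∀ {n} (i : Fin n) (b : Bool) → Σ[ n ] (λ j → ind (eqB i j ∧ b)) ≡ ind b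
Σ-ind-eqB {suc n} zero    b = trans (cong (ind b +_) (Σ-const n 0)) (+-identityʳ (ind b))
Σ-ind-eqB {suc n} (suc i) b =
  trans (Σ-cong n (λ j → cong (λ e → ind (e ∧ b)) (eqB-suc i j))) (Σ-ind-eqB i b)

eqB⇒≡ : ∀ {n} {i j : Fin n} → eqB i j ≡ true → i ≡ j
eqB⇒≡ {i = i} {j} with i ≟ j
... | yes i≡j = λ _ → i≡j
... | no _    = λ ()

row-at-eqB : ∀ {n} (i : Fin n) (b : Fin n → Bool) →
  (∀ j → b j ≡ true → i ≡ j) → ∀ j → b j ≡ eqB i j ∧ b i
row-at-eqB i b onlyAt-i j with i ≟ j
... | yes refl = refl
... | no i≢j   = ¬-not (i≢j ∘ onlyAt-i j)

ind+ind-not : ∀ b → ind b + ind (not b) ≡ 1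
ind+ind-not true  = refl
ind+ind-not false = refl

ind-injective : ∀ {a b} → ind a ≡ ind b → a ≡ b
ind-injective {true}  {true}  _ = refl
ind-injective {false} {false} _ = refl

∣m+n∣n⇒∣m : ∀ {d m n} → d ∣ m + n → d ∣ n → d ∣ m
∣m+n∣n⇒∣m {d} {m} {n} d∣m+n = ∣m+n∣m⇒∣n (subst (d ∣_) (+-comm m n) d∣m+n)

∣n⇒∣m+n⇔∣m : ∀ {d m n} → d ∣ n → (d ∣ m + n ⇔ d ∣ m)
∣n⇒∣m+n⇔∣m d∣n = mk⇔ (λ d∣m+n → ∣m+n∣n⇒∣m d∣m+n d∣n)
  (λ d∣m → ∣m∣n⇒∣m+n d∣m d∣n)

∣m+n⇒∣m⇔∣n : ∀ {d m n} → d ∣ m + n → (d ∣ m ⇔ d ∣ n)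
∣m+n⇒∣m⇔∣n d∣m+n = mk⇔ (∣m+n∣m⇒∣n d∣m+n) (∣m+n∣n⇒∣m d∣m+n)

hFactor-cong : ∀ {m} {G : Graph m} {h h′} → (∀ u → h u ≡ h′ u) → hFactor G h → hFactor G h′
hFactor-cong h≗h′ (F , spanning , F-deg) = F , spanning , (λ u → trans (F-deg u) (h≗h′ u))

-- The degree demanded at v_i in G_L: H(v_i) = {1} asks for 1, H(v_i) = {0,2} for 2.
target : OneOrZeroTwo → ℕ
target one     = 1
target zeroTwo = 2

target+isOne : ∀ o → target o + isOne o ≡ 2
target+isOne one     = refl
target+isOne zeroTwo = refl

target-bounds : ∀ o → 1 ≤ target o × target o ≤ 2
target-bounds one     = ≤-refl , s≤s z≤n
target-bounds zeroTwo = s≤s z≤n , ≤-refl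

demand : ℕ → OneOrZeroTwo
demand 1 = one
demand _ = zeroTwo

target-demand : ∀ {k} → 1 ≤ k → k ≤ 2 → target (demand k) ≡ k
target-demand {1} _ _ = refl
target-demand {2} _ _ = refl
target-demand {suc (suc (suc _))} _ (s≤s (s≤s ()))

-- v_i takes both spokes of its triangle exactly when it has degree 0 in the H-factor.
⟦⟧⇒spoke-degree : ∀ {o d} → ⟦ o ⟧ d → d + (ind (d ≡ᵇ 0) + ind (d ≡ᵇ 0)) ≡ target o
⟦⟧⇒spoke-degree {one}     refl        = refl
⟦⟧⇒spoke-degree {zeroTwo} (inj₁ refl) = refl
⟦⟧⇒spoke-degree {zeroTwo} (inj₂ refl) = refl

spoke-degree⇒⟦⟧ : ∀ o d b → d + (ind b + ind b) ≡ target o → ⟦ o ⟧ d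
spoke-degree⇒⟦⟧ one     d false e = trans (sym (+-identityʳ d)) e
spoke-degree⇒⟦⟧ zeroTwo d false e = inj₂ (trans (sym (+-identityʳ d)) e)
spoke-degree⇒⟦⟧ one     d true  e with () ← trans (+-comm 2 d) e
spoke-degree⇒⟦⟧ zeroTwo d true  e = inj₁ (+-cancelˡ-≡ 2 d 0 (trans (+-comm 2 d) e))

module _ {n : ℕ} where

  inV inX inY : Fin n → Fin (n + (n + n))
  inV i = i ↑ˡ (n + n)
  inX i = n ↑ʳ (i ↑ˡ n)
  inY i = n ↑ʳ (n ↑ʳ i)

  kind-inV : ∀ i → kind (inV i) ≡ vK i
  kind-inV i rewrite splitAt-↑ˡ n i (n + n) = refl

  kind-inX : ∀ i → kind (inX i) ≡ xK i
  kind-inX i rewrite splitAt-↑ʳ n (n + n) (i ↑ˡ n) | splitAt-↑ˡ n i n = refl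

  kind-inY : ∀ i → kind (inY i) ≡ yK i
  kind-inY i rewrite splitAt-↑ʳ n (n + n) (n ↑ʳ i) | splitAt-↑ʳ n n i = refl

  data View : Fin (n + (n + n)) → Set where
    isV : ∀ i → View (inV i)
    isX : ∀ i → View (inX i)
    isY : ∀ i → View (inY i)

  view : ∀ u → View u
  view u with splitAt n u in eq
  ... | inj₁ i = subst View (splitAt⁻¹-↑ˡ eq) (isV i)
  ... | inj₂ j with splitAt n j in eq′
  ...   | inj₁ i = subst View (trans (cong (n ↑ʳ_) (splitAt⁻¹-↑ˡ eq′)) (splitAt⁻¹-↑ʳ eq))
                            (isX i)
  ...   | inj₂ i = subst View (trans (cong (n ↑ʳ_) (splitAt⁻¹-↑ʳ eq′)) (splitAt⁻¹-↑ʳ eq))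
                            (isY i)

  ΣKind : (Kind n → ℕ) → ℕ
  ΣKind φ = Σ[ n ] (φ ∘ vK) + (Σ[ n ] (φ ∘ xK) + Σ[ n ] (φ ∘ yK))

  Σ-∘kind : ∀ φ → Σ[ n + (n + n) ] (φ ∘ kind) ≡ ΣKind φ
  Σ-∘kind φ = begin
    Σ[ n + (n + n) ] (φ ∘ kind)
      ≡⟨ Σ-++ n (n + n) (φ ∘ kind) ⟩
    Σ[ n ] (φ ∘ kind ∘ inV) + Σ[ n + n ] (φ ∘ kind ∘ (n ↑ʳ_))
      ≡⟨ cong (Σ[ n ] (φ ∘ kind ∘ inV) +_) (Σ-++ n n (φ ∘ kind ∘ (n ↑ʳ_))) ⟩
    Σ[ n ] (φ ∘ kind ∘ inV) + (Σ[ n ] (φ ∘ kind ∘ inX) + Σ[ n ] (φ ∘ kind ∘ inY))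
      ≡⟨ cong₂ _+_ (Σ-cong n (cong φ ∘ kind-inV))
                   (cong₂ _+_ (Σ-cong n (cong φ ∘ kind-inX)) (Σ-cong n (cong φ ∘ kind-inY))) ⟩
    ΣKind φ ∎
    where open ≡-Reasoning

  GadgetK : Graph n → (sx sy t : Fin n → Bool) → Kind n → Kind n → Bool
  GadgetK F sx sy t (vK i) (vK j) = F i j
  GadgetK F sx sy t (vK i) (xK j) = eqB i j ∧ sx i
  GadgetK F sx sy t (vK i) (yK j) = eqB i j ∧ sy i
  GadgetK F sx sy t (xK i) (vK j) = eqB i j ∧ sx i
  GadgetK F sx sy t (xK i) (xK j) = false
  GadgetK F sx sy t (xK i) (yK j) = eqB i j ∧ t i
  GadgetK F sx sy t (yK i) (vK j) = eqB i j ∧ sy i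
  GadgetK F sx sy t (yK i) (xK j) = eqB i j ∧ t i
  GadgetK F sx sy t (yK i) (yK j) = false

  Gadget : Graph n → (sx sy t : Fin n → Bool) → Graph (n + (n + n))
  Gadget F sx sy t u w = GadgetK F sx sy t (kind u) (kind w)

  Gadget-sym : ∀ {F} sx sy t → (∀ i j → F i j ≡ F j i) →
    ∀ u w → Gadget F sx sy t u w ≡ Gadget F sx sy t w u
  Gadget-sym {F} sx sy t F-sym u w = onKinds (kind u) (kind w)
    where
    onKinds : ∀ k l → GadgetK F sx sy t k l ≡ GadgetK F sx sy t l k
    onKinds (vK i) (vK j) = F-sym i j
    onKinds (vK i) (xK j) = eqB-∧-sym i j sx
    onKinds (vK i) (yK j) = eqB-∧-sym i j sy
    onKinds (xK i) (vK j) = eqB-∧-sym i j sx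
    onKinds (xK i) (xK j) = refl
    onKinds (xK i) (yK j) = eqB-∧-sym i j t
    onKinds (yK i) (vK j) = eqB-∧-sym i j sy
    onKinds (yK i) (xK j) = eqB-∧-sym i j t
    onKinds (yK i) (yK j) = refl

  Gadget⊆GL : ∀ {G F} sx sy t → (∀ i j → F i j ≡ true → G i j ≡ true) →
    ∀ u w → Gadget F sx sy t u w ≡ true → GL G u w ≡ true
  Gadget⊆GL {G} {F} sx sy t F⊆G u w = onKinds (kind u) (kind w)
    where
    onKinds : ∀ k l → GadgetK F sx sy t k l ≡ true → LAdjK G k l ≡ true
    onKinds (vK i) (vK j) = F⊆G i j
    onKinds (vK i) (xK j) = ∧-conicalˡ _ _
    onKinds (vK i) (yK j) = ∧-conicalˡ _ _
    onKinds (xK i) (vK j) = ∧-conicalˡ _ _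
    onKinds (xK i) (xK j) = λ ()
    onKinds (xK i) (yK j) = ∧-conicalˡ _ _
    onKinds (yK i) (vK j) = ∧-conicalˡ _ _
    onKinds (yK i) (xK j) = ∧-conicalˡ _ _
    onKinds (yK i) (yK j) = λ ()

  deg-Gadget : ∀ F sx sy t {u k} → kind u ≡ k →
    deg (Gadget F sx sy t) u ≡ ΣKind (ind ∘ GadgetK F sx sy t k)
  deg-Gadget F sx sy t {u} refl = Σ-∘kind (ind ∘ GadgetK F sx sy t (kind u))

  deg-Gadget-inV : ∀ F sx sy t i → deg (Gadget F sx sy t) (inV i) ≡ deg F i + (ind (sx i) + ind (sy i))
  deg-Gadget-inV F sx sy t i = trans (deg-Gadget F sx sy t (kind-inV i))
    (cong (deg F i +_) (cong₂ _+_ (Σ-ind-eqB i (sx i)) (Σ-ind-eqB i (sy i))))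

  deg-Gadget-inX : ∀ F sx sy t i → deg (Gadget F sx sy t) (inX i) ≡ ind (sx i) + ind (t i)
  deg-Gadget-inX F sx sy t i = trans (deg-Gadget F sx sy t (kind-inX i))
    (cong₂ _+_ (Σ-ind-eqB i (sx i)) (cong₂ _+_ (Σ-const n 0) (Σ-ind-eqB i (t i))))

  deg-Gadget-inY : ∀ F sx sy t i → deg (Gadget F sx sy t) (inY i) ≡ ind (sy i) + ind (t i)
  deg-Gadget-inY F sx sy t i = trans (deg-Gadget F sx sy t (kind-inY i))
    (cong₂ _+_ (Σ-ind-eqB i (sy i))
               (trans (cong₂ _+_ (Σ-ind-eqB i (t i)) (Σ-const n 0)) (+-identityʳ _)))

  restrictV : Graph (n + (n + n)) → Graph n
  restrictV F i j = F (inV i) (inV j)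

  spokeX spokeY rim : Graph (n + (n + n)) → Fin n → Bool
  spokeX F i = F (inV i) (inX i)
  spokeY F i = F (inV i) (inY i)
  rim    F i = F (inX i) (inY i)

  spanning-GL≡Gadget : ∀ {G F} → SpanningSubgraph (GL G) F →
    ∀ u w → F u w ≡ Gadget (restrictV F) (spokeX F) (spokeY F) (rim F) u w
  spanning-GL≡Gadget {G} {F} (F-sym , F⊆GL) u w = onViews (view u) (view w)
    where
    edge : ∀ {u w k l} → kind u ≡ k → kind w ≡ l → F u w ≡ true → LAdjK G k l ≡ true
    edge {u} {w} refl refl = F⊆GL u w

    nonEdge : ∀ {u w k l} → kind u ≡ k → kind w ≡ l → LAdjK G k l ≡ false → F u w ≡ false
    nonEdge ku kw noGL = ¬-not (false≢true ∘ trans (sym noGL) ∘ edge ku kw)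
      where
      false≢true : false ≡ true → ⊥
      false≢true ()

    spokes : ∀ {u k} (i : Fin n) {inW : Fin n → Fin (n + (n + n))} {toK : Fin n → Kind n} →
      kind u ≡ k → (∀ j → kind (inW j) ≡ toK j) → (∀ j → LAdjK G k (toK j) ≡ eqB i j) →
      ∀ j → F u (inW j) ≡ eqB i j ∧ F u (inW i)
    spokes i ku kinW adj = row-at-eqB i _ (λ j e → eqB⇒≡ (trans (sym (adj j)) (edge ku (kinW j) e)))

    onViews : ∀ {u w} → View u → View w →
      F u w ≡ Gadget (restrictV F) (spokeX F) (spokeY F) (rim F) u w
    onViews (isV i) (isV j) rewrite kind-inV i | kind-inV j = refl
    onViews (isV i) (isX j) rewrite kind-inV i | kind-inX j =
      spokes i (kind-inV i) kind-inX (λ _ → refl) j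
    onViews (isV i) (isY j) rewrite kind-inV i | kind-inY j =
      spokes i (kind-inV i) kind-inY (λ _ → refl) j
    onViews (isX i) (isV j) rewrite kind-inX i | kind-inV j =
      trans (spokes i (kind-inX i) kind-inV (λ _ → refl) j) (cong (eqB i j ∧_) (F-sym _ _))
    onViews (isX i) (isX j) rewrite kind-inX i | kind-inX j = nonEdge (kind-inX i) (kind-inX j) refl
    onViews (isX i) (isY j) rewrite kind-inX i | kind-inY j =
      spokes i (kind-inX i) kind-inY (λ _ → refl) j
    onViews (isY i) (isV j) rewrite kind-inY i | kind-inV j =
      trans (spokes i (kind-inY i) kind-inV (λ _ → refl) j) (cong (eqB i j ∧_) (F-sym _ _))
    onViews (isY i) (isX j) rewrite kind-inY i | kind-inX j =
      trans (spokes i (kind-inY i) kind-inX (λ _ → refl) j) (cong (eqB i j ∧_) (F-sym _ _))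
    onViews (isY i) (isY j) rewrite kind-inY i | kind-inY j = nonEdge (kind-inY i) (kind-inY j) refl

  demandK : (Fin n → OneOrZeroTwo) → Kind n → ℕ
  demandK H (vK i) = target (H i)
  demandK H (xK i) = 1
  demandK H (yK i) = 1

  hL : (Fin n → OneOrZeroTwo) → Fin (n + (n + n)) → ℕ
  hL H = demandK H ∘ kind

  hL-inV : ∀ H i → hL H (inV i) ≡ target (H i)
  hL-inV H i = cong (demandK H) (kind-inV i)

  hL-inX : ∀ H i → hL H (inX i) ≡ 1
  hL-inX H i = cong (demandK H) (kind-inX i)

  hL-inY : ∀ H i → hL H (inY i) ≡ 1
  hL-inY H i = cong (demandK H) (kind-inY i)

  even-hL⇔even-countOnes : ∀ H → 2 ∣ Σ[ n + (n + n) ] (hL H) ⇔ 2 ∣ countOnes H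
  even-hL⇔even-countOnes H =
    ∣m+n⇒∣m⇔∣n (subst (2 ∣_) (sym T+C≡2n) 2∣2n)
      ⇔-∘ subst (λ s → 2 ∣ s ⇔ 2 ∣ T) (sym Σ≡T+2n) (∣n⇒∣m+n⇔∣m 2∣2n)
    where
    T : ℕ
    T = Σ[ n ] (target ∘ H)

    2∣2n : 2 ∣ 2 * n
    2∣2n = m∣m*n n

    Σ≡T+2n : Σ[ n + (n + n) ] (hL H) ≡ T + 2 * n
    Σ≡T+2n = trans (Σ-∘kind (demandK H)) (cong (T +_) (trans (sym (Σ-+ n _ _)) (Σ-const n 2)))

    T+C≡2n : T + countOnes H ≡ 2 * n
    T+C≡2n = trans (sym (Σ-+ n _ _)) (trans (Σ-cong n (target+isOne ∘ H)) (Σ-const n 2))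

  hL-admissible : ∀ H u → gL n u ≤ hL H u × hL H u ≤ fL n u
  hL-admissible H u = onKinds (kind u)
    where
    onKinds : ∀ k → 1 ≤ demandK H k × demandK H k ≤ fK k
    onKinds (vK i) = target-bounds (H i)
    onKinds (xK i) = ≤-refl , ≤-refl
    onKinds (yK i) = ≤-refl , ≤-refl

  admissible⇒≡hL : ∀ {h} → (∀ u → gL n u ≤ h u × h u ≤ fL n u) →
    ∀ u → h u ≡ hL (demand ∘ h ∘ inV) u
  admissible⇒≡hL {h} admissible u = onViews (view u)
    where
    H : Fin n → OneOrZeroTwo
    H = demand ∘ h ∘ inV

    upper : ∀ {u k} → kind u ≡ k → h u ≤ fK k
    upper {u} refl = proj₂ (admissible u)

    lower : ∀ u → 1 ≤ h u
    lower u = proj₁ (admissible u)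

    onViews : ∀ {u} → View u → h u ≡ hL H u
    onViews (isV i) = sym (trans (hL-inV H i) (target-demand (lower (inV i)) (upper (kind-inV i))))
    onViews (isX i) = trans (≤-antisym (upper (kind-inX i)) (lower (inX i))) (sym (hL-inX H i))
    onViews (isY i) = trans (≤-antisym (upper (kind-inY i)) (lower (inY i))) (sym (hL-inY H i))

  HFactor⇒hFactor-GL : ∀ G H → HFactor G (λ v → ⟦ H v ⟧) → hFactor (GL G) (hL H)
  HFactor⇒hFactor-GL G H (F , (F-sym , F⊆G) , F-deg) =
    Gadget F p p (not ∘ p) , (Gadget-sym p p (not ∘ p) F-sym , Gadget⊆GL p p (not ∘ p) F⊆G) , degree
    where
    p : Fin n → Bool
    p i = deg F i ≡ᵇ 0

    onViews : ∀ {u} → View u → deg (Gadget F p p (not ∘ p)) u ≡ hL H u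
    onViews (isV i) = trans (deg-Gadget-inV F p p (not ∘ p) i)
      (trans (⟦⟧⇒spoke-degree (F-deg i)) (sym (hL-inV H i)))
    onViews (isX i) = trans (deg-Gadget-inX F p p (not ∘ p) i)
      (trans (ind+ind-not (p i)) (sym (hL-inX H i)))
    onViews (isY i) = trans (deg-Gadget-inY F p p (not ∘ p) i)
      (trans (ind+ind-not (p i)) (sym (hL-inY H i)))

    degree : ∀ u → deg (Gadget F p p (not ∘ p)) u ≡ hL H u
    degree u = onViews (view u)

  hFactor-GL⇒HFactor : ∀ G H → hFactor (GL G) (hL H) → HFactor G (λ v → ⟦ H v ⟧)
  hFactor-GL⇒HFactor G H (F , spanning@(F-sym , F⊆GL) , F-deg) =
    restrictV F , ((λ i j → F-sym (inV i) (inV j)) , F′⊆G) , degree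
    where
    F′ : Graph n
    F′ = restrictV F

    F° : Graph (n + (n + n))
    F° = Gadget F′ (spokeX F) (spokeY F) (rim F)

    F′⊆G : ∀ i j → F′ i j ≡ true → G i j ≡ true
    F′⊆G i j e =
      subst₂ (λ k l → LAdjK G k l ≡ true) (kind-inV i) (kind-inV j) (F⊆GL (inV i) (inV j) e)

    deg-F° : ∀ u → deg F° u ≡ hL H u
    deg-F° u = trans (Σ-cong _ (λ w → cong ind (sym (spanning-GL≡Gadget spanning u w)))) (F-deg u)

    degree : ∀ i → ⟦ H i ⟧ (deg F′ i)
    degree i = spoke-degree⇒⟦⟧ (H i) (deg F′ i) (spokeX F i)
      (subst (λ b → deg F′ i + (ind (spokeX F i) + ind b) ≡ target (H i)) spokes-agree at-v)
      where
      at-v : deg F′ i + (ind (spokeX F i) + ind (spokeY F i)) ≡ target (H i)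
      at-v = trans (sym (deg-Gadget-inV F′ _ _ _ i)) (trans (deg-F° (inV i)) (hL-inV H i))
      at-x : ind (spokeX F i) + ind (rim F i) ≡ 1
      at-x = trans (sym (deg-Gadget-inX F′ _ _ _ i)) (trans (deg-F° (inX i)) (hL-inX H i))
      at-y : ind (spokeY F i) + ind (rim F i) ≡ 1
      at-y = trans (sym (deg-Gadget-inY F′ _ _ _ i)) (trans (deg-F° (inY i)) (hL-inY H i))
      spokes-agree : spokeY F i ≡ spokeX F i
      spokes-agree = ind-injective (+-cancelʳ-≡ (ind (rim F i)) _ _ (trans at-y (sym at-x)))

lemma2p5 : (n : ℕ) (G : Graph n) → Simple G → Cubic G → Connected G →
    ((∀ (H : Fin n → OneOrZeroTwo) → 2 ∣ countOnes H → HFactor G (λ v → ⟦ H v ⟧))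
      → AllFactors (GL G) (gL n) (fL n))
    × (AllFactors (GL G) (gL n) (fL n) →
      ∀ (H : Fin n → OneOrZeroTwo) → 2 ∣ countOnes H → HFactor G (λ v → ⟦ H v ⟧))
lemma2p5 n G _ _ _ = allHFactors⇒allFactors , allFactors⇒allHFactors
  where
  AllHFactors : Set
  AllHFactors = ∀ (H : Fin n → OneOrZeroTwo) → 2 ∣ countOnes H → HFactor G (λ v → ⟦ H v ⟧)

  allHFactors⇒allFactors : AllHFactors → AllFactors (GL G) (gL n) (fL n)
  allHFactors⇒allFactors HF h admissible 2∣Σh =
    hFactor-cong (sym ∘ h≡hL) (HFactor⇒hFactor-GL G H (HF H 2∣ones))
    where
    H : Fin n → OneOrZeroTwo
    H = demand ∘ h ∘ inV
    h≡hL : ∀ u → h u ≡ hL H u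
    h≡hL = admissible⇒≡hL admissible
    2∣ones : 2 ∣ countOnes H
    2∣ones = Equivalence.to (even-hL⇔even-countOnes H) (subst (2 ∣_) (Σ-cong _ h≡hL) 2∣Σh)

  allFactors⇒allHFactors : AllFactors (GL G) (gL n) (fL n) → AllHFactors
  allFactors⇒allHFactors AF H 2∣ones =
    hFactor-GL⇒HFactor G H
      (AF (hL H) (hL-admissible H) (Equivalence.from (even-hL⇔even-countOnes H) 2∣ones))
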